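{- Let $\ell\geq 1$ be an integer. For an integer $s\geq 0$ and $\mathbf{a}=(a_0,\ldots,a_\ell)\in\mathbb{R}^{\ell+1}$ let $A_{s,\mathbf{a}}\in M_{\ell+1}(\mathbb{R})$ be the matrix with entries $(A_{s,\mathbf{a}})_{ij}=\big((i-1)(\ell+1)+j\big)^{\ell-1}$ for $1\leq i\leq \ell$, $1\leq j\leq \ell+1$, and $(A_{s,\mathbf{a}})_{\ell+1,j}=(j-1)^s a_{j-1}$ for $1\le j\le \ell+1$ (so its rows are $(1^{\ell-1},\ldots,(\ell+1)^{\ell-1})$, $((\ell+2)^{\ell-1},\ldots,(2\ell+2)^{\ell-1})$, $\ldots$, $((\ell^2)^{\ell-1},\ldots,(\ell^2+\ell)^{\ell-1})$, $(0^sa_0,1^sa_1,\ldots,\ell^sa_\ell)$). Then there is a constant $\sigma_\ell$ depending only on $\ell$ such that for all $s\ge 0$ and all $\mathbf{a}$, \[ \det(A_{s,\mathbf{a}})=\sigma_\ell\sum_{j=0}^{\ell}(-1)^j\binom{\ell}{j}j^s a_j . \]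
   Context: The convention $0^0=1$ is used. -}

module Defs where

open import Level using (Level)
open import Algebra.Bundles using (CommutativeRing)
open import Data.Nat as ℕ using (ℕ; zero; suc)
open import Data.Nat.Combinatorics using (_C_)
open import Data.Fin using (Fin; toℕ; punchIn)
import Data.Fin as Fin
open import Data.Bool using (if_then_else_)
open import Relation.Nullary.Decidable using (⌊_⌋)

module _ {c r : Level} (R : CommutativeRing c r) where
  open CommutativeRing R

  fromℕ : ℕ → Carrier
  fromℕ zero = 0#
  fromℕ (suc n) = 1# + fromℕ n

  -- x^n with x^0 = 1 (so 0^0 = 1)
  pow : Carrier → ℕ → Carrier
  pow x zero = 1#
  pow x (suc n) = x * pow x n

  sumFin : (n : ℕ) → (Fin n → Carrier) → Carrier
  sumFin zero f = 0#
  sumFin (suc n) f = f Fin.zero + sumFin n (λ j → f (Fin.suc j))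

  det : (n : ℕ) → (Fin n → Fin n → Carrier) → Carrier
  det zero M = 1#
  det (suc n) M =
    sumFin (suc n) (λ j → pow (- 1#) (toℕ j) * (M Fin.zero j
                     * det n (λ i k → M (Fin.suc i) (punchIn j k))))

  -- The (ℓ+1)×(ℓ+1) matrix A_{s,a} (0-indexed rows i and columns j):
  --   row i < ℓ : entry (i(ℓ+1) + j + 1)^(ℓ-1)
  --   row ℓ     : entry j^s · a_j
  A : (ℓ s : ℕ) → (Fin (suc ℓ) → Carrier) → Fin (suc ℓ) → Fin (suc ℓ) → Carrier
  A ℓ s a i j =
    if ⌊ toℕ i ℕ.<? ℓ ⌋
    then fromℕ ((toℕ i ℕ.* suc ℓ ℕ.+ suc (toℕ j)) ℕ.^ (ℓ ℕ.∸ 1))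
    else fromℕ (toℕ j ℕ.^ s) * a j

  rhsSum : (ℓ s : ℕ) → (Fin (suc ℓ) → Carrier) → Carrier
  rhsSum ℓ s a =
    sumFin (suc ℓ) (λ j → pow (- 1#) (toℕ j)
                          * (fromℕ (ℓ C toℕ j) * (fromℕ (toℕ j ℕ.^ s) * a j)))

module Submission where

-- With weights w t = (-1)^t C(ℓ,t), replacing the last column of A by Σ_t w t · (column t)
-- multiplies the determinant by w ℓ = (-1)^ℓ. In a row i < ℓ the new entry is
-- Σ_t (-1)^t C(ℓ,t) (x + t)^(ℓ-1) with x = i(ℓ+1) + 1, up to sign the ℓ-th forward difference
-- of a polynomial of degree ℓ - 1, hence 0; in the last row it is the right-hand sum. Expanding
-- along the new last column gives det A = (-1)^ℓ · rhsSum · det B, where the upper left ℓ × ℓ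
-- block B does not involve s or a. Multilinearity and alternation in the columns are derived
-- from the first-row Laplace expansion defining det: two equal adjacent columns make the two
-- corresponding cofactors cancel, and adjacent swaps reduce the general case to that one.

open import Defs
open import Level using (Level)
open import Algebra.Bundles using (CommutativeRing)
open import Data.Nat as ℕ using (ℕ; zero; suc; _≤_; z≤n; s≤s)
import Data.Nat.Properties as ℕ
open import Data.Nat.Combinatorics
  using (_C_; nC1≡n; nCn≡1; k>n⇒nCk≡0; nCk+nC[k+1]≡[n+1]C[k+1])
open import Data.Fin as Fin using (Fin; toℕ; punchIn; punchOut; inject₁)
import Data.Fin.Properties as Fin
open import Data.Product using (∃; _×_; _,_)
open import Data.Empty using (⊥-elim)
open import Function using (_∘_)
open import Relation.Binary.PropositionalEquality as ≡ using (_≡_; _≢_; module ≡-Reasoning)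
open import Relation.Binary.Definitions using (tri<; tri≈; tri>)
open import Relation.Nullary using (yes; no)

[k+1]*[n+1]C[k+1]≡[n+1]*nCk : ∀ n k → suc k ℕ.* (suc n C suc k) ≡ suc n ℕ.* (n C k)
[k+1]*[n+1]C[k+1]≡[n+1]*nCk n zero = begin
  1 ℕ.* (suc n C 1) ≡⟨ ℕ.*-identityˡ _ ⟩
  suc n C 1         ≡⟨ nC1≡n (suc n) ⟩
  suc n             ≡⟨ ℕ.*-identityʳ (suc n) ⟨
  suc n ℕ.* 1       ∎
  where open ≡-Reasoning
[k+1]*[n+1]C[k+1]≡[n+1]*nCk zero (suc k) = begin
  (2 ℕ.+ k) ℕ.* (1 C (2 ℕ.+ k))
    ≡⟨ ≡.cong ((2 ℕ.+ k) ℕ.*_) (k>n⇒nCk≡0 {1} {2 ℕ.+ k} (s≤s (s≤s z≤n))) ⟩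
  (2 ℕ.+ k) ℕ.* 0
    ≡⟨ ℕ.*-zeroʳ (2 ℕ.+ k) ⟩
  0 ∎
  where open ≡-Reasoning
[k+1]*[n+1]C[k+1]≡[n+1]*nCk (suc n) (suc k) = begin
  (2 ℕ.+ k) ℕ.* ((2 ℕ.+ n) C (2 ℕ.+ k))
    ≡⟨ ≡.cong ((2 ℕ.+ k) ℕ.*_) (nCk+nC[k+1]≡[n+1]C[k+1] (suc n) (suc k)) ⟨
  (2 ℕ.+ k) ℕ.* (b ℕ.+ c)
    ≡⟨ ℕ.*-distribˡ-+ (2 ℕ.+ k) b c ⟩
  (b ℕ.+ (1 ℕ.+ k) ℕ.* b) ℕ.+ (2 ℕ.+ k) ℕ.* c
    ≡⟨ ≡.cong₂ (λ u v → (b ℕ.+ u) ℕ.+ v) ([k+1]*[n+1]C[k+1]≡[n+1]*nCk n k)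
                                          ([k+1]*[n+1]C[k+1]≡[n+1]*nCk n (suc k)) ⟩
  (b ℕ.+ (1 ℕ.+ n) ℕ.* (n C k)) ℕ.+ (1 ℕ.+ n) ℕ.* (n C suc k)
    ≡⟨ ℕ.+-assoc b _ _ ⟩
  b ℕ.+ ((1 ℕ.+ n) ℕ.* (n C k) ℕ.+ (1 ℕ.+ n) ℕ.* (n C suc k))
    ≡⟨ ≡.cong (b ℕ.+_) (ℕ.*-distribˡ-+ (1 ℕ.+ n) (n C k) (n C suc k)) ⟨
  b ℕ.+ (1 ℕ.+ n) ℕ.* (n C k ℕ.+ n C suc k)
    ≡⟨ ≡.cong (λ u → b ℕ.+ (1 ℕ.+ n) ℕ.* u) (nCk+nC[k+1]≡[n+1]C[k+1] n k) ⟩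
  (2 ℕ.+ n) ℕ.* b ∎
  where
  open ≡-Reasoning
  b = suc n C suc k
  c = suc n C suc (suc k)

inject₁≢suc : ∀ {n} (i : Fin n) → inject₁ i ≢ Fin.suc i
inject₁≢suc i eq = ℕ.1+n≢n (≡.trans (≡.sym (≡.cong toℕ eq)) (Fin.toℕ-inject₁ i))

punchIn-inject₁ : ∀ {n} (j : Fin (suc n)) (k : Fin n) →
                  punchIn (inject₁ j) (inject₁ k) ≡ inject₁ (punchIn j k)
punchIn-inject₁ Fin.zero    k           = ≡.refl
punchIn-inject₁ (Fin.suc j) Fin.zero    = ≡.refl
punchIn-inject₁ (Fin.suc j) (Fin.suc k) = ≡.cong Fin.suc (punchIn-inject₁ j k)

punchIn-inject₁-fromℕ : ∀ {n} (j : Fin (suc n)) → punchIn (inject₁ j) (Fin.fromℕ n) ≡ Fin.fromℕ (suc n)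
punchIn-inject₁-fromℕ {zero}  Fin.zero    = ≡.refl
punchIn-inject₁-fromℕ {suc n} Fin.zero    = ≡.refl
punchIn-inject₁-fromℕ {suc n} (Fin.suc j) = ≡.cong Fin.suc (punchIn-inject₁-fromℕ j)

punchOut-adjacent : ∀ {n} (j : Fin (suc (suc n))) (i : Fin (suc n)) →
                   j ≢ inject₁ i → j ≢ Fin.suc i →
                   ∃ λ (i′ : Fin n) →
                     punchIn j (inject₁ i′) ≡ inject₁ i × punchIn j (Fin.suc i′) ≡ Fin.suc i
punchOut-adjacent Fin.zero Fin.zero j≢i _ = ⊥-elim (j≢i ≡.refl)
punchOut-adjacent Fin.zero (Fin.suc i) _ _ = i , ≡.refl , ≡.refl
punchOut-adjacent (Fin.suc Fin.zero) Fin.zero _ j≢1+i = ⊥-elim (j≢1+i ≡.refl)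
punchOut-adjacent {suc n} (Fin.suc (Fin.suc j)) Fin.zero _ _ = Fin.zero , ≡.refl , ≡.refl
punchOut-adjacent {suc n} (Fin.suc j) (Fin.suc i) j≢i j≢1+i
  with punchOut-adjacent j i (j≢i ∘ ≡.cong Fin.suc) (j≢1+i ∘ ≡.cong Fin.suc)
... | i′ , p , q = Fin.suc i′ , ≡.cong Fin.suc p , ≡.cong Fin.suc q

module _ {c r : Level} (R : CommutativeRing c r) where
  open CommutativeRing R hiding (zero)
  open import Algebra.Properties.Ring ring using (-1*x≈-x; -0#≈0#; -‿distribˡ-*; -‿distribʳ-*; -‿involutive)
  open import Relation.Binary.Reasoning.Setoid setoid
  open import Algebra.Solver.Ring.NaturalCoefficients.Default commutativeSemiring

  sumFin-cong : ∀ n {f g : Fin n → Carrier} → (∀ j → f j ≈ g j) → sumFin R n f ≈ sumFin R n g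
  sumFin-cong zero    f≈g = refl
  sumFin-cong (suc n) f≈g = +-cong (f≈g Fin.zero) (sumFin-cong n (f≈g ∘ Fin.suc))

  sumFin-distrib-+ : ∀ n (f g : Fin n → Carrier) →
                     sumFin R n (λ j → f j + g j) ≈ sumFin R n f + sumFin R n g
  sumFin-distrib-+ zero    f g = sym (+-identityˡ 0#)
  sumFin-distrib-+ (suc n) f g = begin
    (f₀ + g₀) + sumFin R n (λ j → f (Fin.suc j) + g (Fin.suc j))
      ≈⟨ +-congˡ (sumFin-distrib-+ n (f ∘ Fin.suc) (g ∘ Fin.suc)) ⟩
    (f₀ + g₀) + (sumFin R n (f ∘ Fin.suc) + sumFin R n (g ∘ Fin.suc))
      ≈⟨ +-assoc f₀ g₀ _ ⟩
    f₀ + (g₀ + (sumFin R n (f ∘ Fin.suc) + sumFin R n (g ∘ Fin.suc)))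
      ≈⟨ +-congˡ (x∙yz≈y∙xz g₀ _ _) ⟩
    f₀ + (sumFin R n (f ∘ Fin.suc) + (g₀ + sumFin R n (g ∘ Fin.suc)))
      ≈⟨ +-assoc f₀ _ _ ⟨
    (f₀ + sumFin R n (f ∘ Fin.suc)) + (g₀ + sumFin R n (g ∘ Fin.suc)) ∎
    where
    open import Algebra.Properties.CommutativeSemigroup +-commutativeSemigroup using (x∙yz≈y∙xz)
    f₀ = f Fin.zero
    g₀ = g Fin.zero

  *-distribˡ-sumFin : ∀ n x (f : Fin n → Carrier) → x * sumFin R n f ≈ sumFin R n (λ j → x * f j)
  *-distribˡ-sumFin zero    x f = zeroʳ x
  *-distribˡ-sumFin (suc n) x f = trans (distribˡ x _ _) (+-congˡ (*-distribˡ-sumFin n x (f ∘ Fin.suc)))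

  sumFin-zero : ∀ {n} {f : Fin n → Carrier} → (∀ j → f j ≈ 0#) → sumFin R n f ≈ 0#
  sumFin-zero {zero}  f≈0 = refl
  sumFin-zero {suc n} f≈0 = trans (+-cong (f≈0 Fin.zero) (sumFin-zero (f≈0 ∘ Fin.suc))) (+-identityˡ 0#)

  sumFin-single : ∀ {n} {f : Fin n → Carrier} (k : Fin n) → (∀ j → j ≢ k → f j ≈ 0#) →
                  sumFin R n f ≈ f k
  sumFin-single {suc n} Fin.zero f≈0 =
    trans (+-congˡ (sumFin-zero (λ j → f≈0 (Fin.suc j) λ ()))) (+-identityʳ _)
  sumFin-single {suc n} (Fin.suc k) f≈0 =
    trans (+-cong (f≈0 Fin.zero λ ())
                  (sumFin-single k (λ j j≢k → f≈0 (Fin.suc j) (j≢k ∘ Fin.suc-injective))))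
          (+-identityˡ _)

  sumFin-pair : ∀ {n} {f : Fin n → Carrier} (p q : Fin n) → p ≢ q →
                (∀ j → j ≢ p → j ≢ q → f j ≈ 0#) → sumFin R n f ≈ f p + f q
  sumFin-pair Fin.zero Fin.zero p≢q _ = ⊥-elim (p≢q ≡.refl)
  sumFin-pair {suc n} Fin.zero (Fin.suc q) _ f≈0 =
    +-congˡ (sumFin-single q (λ j j≢q → f≈0 (Fin.suc j) (λ ()) (j≢q ∘ Fin.suc-injective)))
  sumFin-pair {suc n} (Fin.suc p) Fin.zero _ f≈0 =
    trans (+-congˡ (sumFin-single p (λ j j≢p → f≈0 (Fin.suc j) (j≢p ∘ Fin.suc-injective) (λ ()))))
          (+-comm _ _)
  sumFin-pair {suc n} (Fin.suc p) (Fin.suc q) p≢q f≈0 =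
    trans (+-cong (f≈0 Fin.zero (λ ()) (λ ()))
                  (sumFin-pair p q (p≢q ∘ ≡.cong Fin.suc)
                    (λ j j≢p j≢q →
                       f≈0 (Fin.suc j) (j≢p ∘ Fin.suc-injective) (j≢q ∘ Fin.suc-injective))))
          (+-identityˡ _)

  sumFin-init-last : ∀ n (f : Fin (suc n) → Carrier) →
                     sumFin R (suc n) f ≈ sumFin R n (f ∘ inject₁) + f (Fin.fromℕ n)
  sumFin-init-last zero    f = trans (+-identityʳ _) (sym (+-identityˡ _))
  sumFin-init-last (suc n) f = trans (+-congˡ (sumFin-init-last n (f ∘ Fin.suc))) (sym (+-assoc _ _ _))

  sumFin-toℕ-last : ∀ n (g : ℕ → Carrier) → sumFin R (suc n) (g ∘ toℕ) ≈ sumFin R n (g ∘ toℕ) + g n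
  sumFin-toℕ-last n g = trans (sumFin-init-last n (g ∘ toℕ))
    (+-cong (sumFin-cong n λ j → reflexive (≡.cong g (Fin.toℕ-inject₁ j)))
            (reflexive (≡.cong g (Fin.toℕ-fromℕ n))))

  fromℕ-+ : ∀ m n → fromℕ R (m ℕ.+ n) ≈ fromℕ R m + fromℕ R n
  fromℕ-+ zero    n = sym (+-identityˡ _)
  fromℕ-+ (suc m) n = trans (+-congˡ (fromℕ-+ m n)) (sym (+-assoc _ _ _))

  fromℕ-* : ∀ m n → fromℕ R (m ℕ.* n) ≈ fromℕ R m * fromℕ R n
  fromℕ-* zero    n = sym (zeroˡ _)
  fromℕ-* (suc m) n = begin
    fromℕ R (n ℕ.+ m ℕ.* n)                ≈⟨ fromℕ-+ n (m ℕ.* n) ⟩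
    fromℕ R n + fromℕ R (m ℕ.* n)          ≈⟨ +-cong (sym (*-identityˡ _)) (fromℕ-* m n) ⟩
    1# * fromℕ R n + fromℕ R m * fromℕ R n ≈⟨ distribʳ _ _ _ ⟨
    (1# + fromℕ R m) * fromℕ R n           ∎

  pow-congˡ : ∀ {x y} n → x ≈ y → pow R x n ≈ pow R y n
  pow-congˡ zero    x≈y = refl
  pow-congˡ (suc n) x≈y = *-cong x≈y (pow-congˡ n x≈y)

  fromℕ-^ : ∀ m n → fromℕ R (m ℕ.^ n) ≈ pow R (fromℕ R m) n
  fromℕ-^ m zero    = +-identityʳ 1#
  fromℕ-^ m (suc n) = trans (fromℕ-* m (m ℕ.^ n)) (*-congˡ (fromℕ-^ m n))

  sign : ℕ → Carrier
  sign = pow R (- 1#)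

  sign-suc : ∀ n → sign (suc n) ≈ - sign n
  sign-suc n = -1*x≈-x (sign n)

  sign²≈1 : ∀ n → sign n * sign n ≈ 1#
  sign²≈1 zero    = *-identityˡ 1#
  sign²≈1 (suc n) = begin
    sign (suc n) * sign (suc n) ≈⟨ *-cong (sign-suc n) (sign-suc n) ⟩
    - sign n * - sign n         ≈⟨ -‿distribˡ-* (sign n) (- sign n) ⟨
    - (sign n * - sign n)       ≈⟨ -‿cong (-‿distribʳ-* (sign n) (sign n)) ⟨
    - - (sign n * sign n)       ≈⟨ -‿involutive _ ⟩
    sign n * sign n             ≈⟨ sign²≈1 n ⟩
    1#                          ∎

  Matrix : ℕ → Set c
  Matrix n = Fin n → Fin n → Carrier

  column : ∀ {n} → Matrix n → Fin n → Fin n → Carrier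
  column M k r = M r k

  minor : ∀ {n} → Fin (suc n) → Matrix (suc n) → Matrix n
  minor j M r l = M (Fin.suc r) (punchIn j l)

  laplaceTerm : ∀ {n} → Matrix (suc n) → Fin (suc n) → Carrier
  laplaceTerm {n} M j = sign (toℕ j) * (M Fin.zero j * det R n (minor j M))

  det-cong : ∀ {n} {M N : Matrix n} → (∀ r l → M r l ≈ N r l) → det R n M ≈ det R n N
  det-cong {zero}  M≈N = refl
  det-cong {suc n} M≈N = sumFin-cong (suc n) λ j →
    *-congˡ {sign (toℕ j)} (*-cong (M≈N Fin.zero j) (det-cong λ r l → M≈N (Fin.suc r) (punchIn j l)))

  det-linear-column : ∀ {n} (k : Fin n) (a b : Carrier) {M N₁ N₂ : Matrix n} →
    (∀ r l → l ≢ k → M r l ≈ N₁ r l) → (∀ r l → l ≢ k → M r l ≈ N₂ r l) →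
    (∀ r → M r k ≈ a * N₁ r k + b * N₂ r k) →
    det R n M ≈ a * det R n N₁ + b * det R n N₂
  det-linear-column {suc n} k a b {M} {N₁} {N₂} off₁ off₂ onk = begin
    sumFin R (suc n) (laplaceTerm M)
      ≈⟨ sumFin-cong (suc n) term ⟩
    sumFin R (suc n) (λ j → a * laplaceTerm N₁ j + b * laplaceTerm N₂ j)
      ≈⟨ sumFin-distrib-+ (suc n) (λ j → a * laplaceTerm N₁ j) (λ j → b * laplaceTerm N₂ j) ⟩
    sumFin R (suc n) (λ j → a * laplaceTerm N₁ j) + sumFin R (suc n) (λ j → b * laplaceTerm N₂ j)
      ≈⟨ +-cong (*-distribˡ-sumFin (suc n) a (laplaceTerm N₁))
                (*-distribˡ-sumFin (suc n) b (laplaceTerm N₂)) ⟨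
    a * sumFin R (suc n) (laplaceTerm N₁) + b * sumFin R (suc n) (laplaceTerm N₂) ∎
    where
    term : ∀ j → laplaceTerm M j ≈ a * laplaceTerm N₁ j + b * laplaceTerm N₂ j
    term j with j Fin.≟ k
    ... | yes ≡.refl = begin
      s * (M Fin.zero j * det R n (minor j M))
        ≈⟨ *-congˡ (*-cong (onk Fin.zero) (det-cong λ r l → off₁ (Fin.suc r) _ (Fin.punchInᵢ≢i j l))) ⟩
      s * ((a * N₁ Fin.zero j + b * N₂ Fin.zero j) * det R n (minor j N₁))
        ≈⟨ solve 6 (λ s a b x y d →
                      s :* ((a :* x :+ b :* y) :* d) := a :* (s :* (x :* d)) :+ b :* (s :* (y :* d)))
                 refl s a b (N₁ Fin.zero j) (N₂ Fin.zero j) _ ⟩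
      a * (s * (N₁ Fin.zero j * det R n (minor j N₁))) + b * (s * (N₂ Fin.zero j * det R n (minor j N₁)))
        ≈⟨ +-congˡ (*-congˡ (*-congˡ (*-congˡ (det-cong λ r l →
             trans (sym (off₁ (Fin.suc r) _ (Fin.punchInᵢ≢i j l)))
                   (off₂ (Fin.suc r) _ (Fin.punchInᵢ≢i j l)))))) ⟩
      a * laplaceTerm N₁ j + b * laplaceTerm N₂ j ∎
      where s = sign (toℕ j)
    ... | no j≢k = begin
      s * (M Fin.zero j * det R n (minor j M))
        ≈⟨ *-congˡ (*-congˡ minor-linear) ⟩
      s * (M Fin.zero j * (a * det R n (minor j N₁) + b * det R n (minor j N₂)))
        ≈⟨ solve 6 (λ s a b x u v →
                      s :* (x :* (a :* u :+ b :* v)) := a :* (s :* (x :* u)) :+ b :* (s :* (x :* v)))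
                 refl s a b (M Fin.zero j) _ _ ⟩
      a * (s * (M Fin.zero j * det R n (minor j N₁))) + b * (s * (M Fin.zero j * det R n (minor j N₂)))
        ≈⟨ +-cong (*-congˡ (*-congˡ (*-congʳ (off₁ Fin.zero j j≢k))))
                  (*-congˡ (*-congˡ (*-congʳ (off₂ Fin.zero j j≢k)))) ⟩
      a * laplaceTerm N₁ j + b * laplaceTerm N₂ j ∎
      where
      s = sign (toℕ j)
      k′ = punchOut j≢k
      punchIn≢k : ∀ l → l ≢ k′ → punchIn j l ≢ k
      punchIn≢k l l≢k′ eq =
        l≢k′ (Fin.punchIn-injective j l k′ (≡.trans eq (≡.sym (Fin.punchIn-punchOut j≢k))))
      minor-linear : det R n (minor j M) ≈ a * det R n (minor j N₁) + b * det R n (minor j N₂)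
      minor-linear = det-linear-column k′ a b
        (λ r l l≢k′ → off₁ (Fin.suc r) _ (punchIn≢k l l≢k′))
        (λ r l l≢k′ → off₂ (Fin.suc r) _ (punchIn≢k l l≢k′))
        (λ r → ≡.subst (λ l → M (Fin.suc r) l ≈ a * N₁ (Fin.suc r) l + b * N₂ (Fin.suc r) l)
                       (≡.sym (Fin.punchIn-punchOut j≢k)) (onk (Fin.suc r)))

  det-additive-column : ∀ {n} (k : Fin n) {M N₁ N₂ : Matrix n} →
    (∀ r l → l ≢ k → M r l ≈ N₁ r l) → (∀ r l → l ≢ k → M r l ≈ N₂ r l) →
    (∀ r → M r k ≈ N₁ r k + N₂ r k) → det R n M ≈ det R n N₁ + det R n N₂
  det-additive-column k off₁ off₂ onk =
    trans (det-linear-column k 1# 1# off₁ off₂ (λ r → trans (onk r) (sym 1*x+1*y≈x+y)))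
          1*x+1*y≈x+y
    where
    1*x+1*y≈x+y : ∀ {x y} → 1# * x + 1# * y ≈ x + y
    1*x+1*y≈x+y = +-cong (*-identityˡ _) (*-identityˡ _)

  det-zero-column : ∀ {n} (k : Fin n) {M : Matrix n} → (∀ r → M r k ≈ 0#) → det R n M ≈ 0#
  det-zero-column k M≈0 =
    trans (det-linear-column k 0# 0# (λ _ _ _ → refl) (λ _ _ _ → refl)
                             (λ r → trans (M≈0 r) (sym 0*x+0*y≈0)))
          0*x+0*y≈0
    where
    0*x+0*y≈0 : ∀ {x y} → 0# * x + 0# * y ≈ 0#
    0*x+0*y≈0 = trans (+-cong (zeroˡ _) (zeroˡ _)) (+-identityˡ 0#)

  -- punchIn (inject₁ i) and punchIn (suc i) differ only by swapping inject₁ i and suc i.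
  punchIn-adjacent-≈ : ∀ {n} (x : Fin (suc n) → Carrier) (i : Fin n) → x (inject₁ i) ≈ x (Fin.suc i) →
                       ∀ l → x (punchIn (inject₁ i) l) ≈ x (punchIn (Fin.suc i) l)
  punchIn-adjacent-≈ x Fin.zero    same Fin.zero    = sym same
  punchIn-adjacent-≈ x Fin.zero    same (Fin.suc l) = refl
  punchIn-adjacent-≈ x (Fin.suc i) same Fin.zero    = refl
  punchIn-adjacent-≈ x (Fin.suc i) same (Fin.suc l) = punchIn-adjacent-≈ (x ∘ Fin.suc) i same l

  det-adjacent-equal-columns : ∀ {n} (M : Matrix (suc n)) (i : Fin n) →
                        (∀ r → M r (inject₁ i) ≈ M r (Fin.suc i)) → det R (suc n) M ≈ 0#
  det-adjacent-equal-columns {suc n} M i same = begin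
    sumFin R (suc (suc n)) (laplaceTerm M)
      ≈⟨ sumFin-pair (inject₁ i) (Fin.suc i) (inject₁≢suc i) other-vanishes ⟩
    laplaceTerm M (inject₁ i) + laplaceTerm M (Fin.suc i)
      ≈⟨ +-congˡ suc-cancels ⟩
    laplaceTerm M (inject₁ i) - laplaceTerm M (inject₁ i)
      ≈⟨ -‿inverseʳ _ ⟩
    0# ∎
    where
    suc-cancels : laplaceTerm M (Fin.suc i) ≈ - laplaceTerm M (inject₁ i)
    suc-cancels = begin
      sign (suc (toℕ i)) * (M Fin.zero (Fin.suc i) * det R (suc n) (minor (Fin.suc i) M))
        ≈⟨ *-cong (sign-suc (toℕ i)) (*-cong (sym (same Fin.zero)) (det-cong λ r l →
             sym (punchIn-adjacent-≈ (M (Fin.suc r)) i (same (Fin.suc r)) l))) ⟩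
      - sign (toℕ i) * (M Fin.zero (inject₁ i) * det R (suc n) (minor (inject₁ i) M))
        ≈⟨ -‿distribˡ-* _ _ ⟨
      - (sign (toℕ i) * (M Fin.zero (inject₁ i) * det R (suc n) (minor (inject₁ i) M)))
        ≡⟨ ≡.cong (λ t → - (sign t * (M Fin.zero (inject₁ i) * det R (suc n) (minor (inject₁ i) M))))
                  (Fin.toℕ-inject₁ i) ⟨
      - laplaceTerm M (inject₁ i) ∎
    other-vanishes : ∀ j → j ≢ inject₁ i → j ≢ Fin.suc i → laplaceTerm M j ≈ 0#
    other-vanishes j j≢p j≢q with punchOut-adjacent j i j≢p j≢q
    ... | i′ , p , q = begin
      sign (toℕ j) * (M Fin.zero j * det R (suc n) (minor j M))
        ≈⟨ *-congˡ (*-congˡ (det-adjacent-equal-columns (minor j M) i′ λ r →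
             ≡.subst₂ (λ a b → M (Fin.suc r) a ≈ M (Fin.suc r) b) (≡.sym p) (≡.sym q)
                      (same (Fin.suc r)))) ⟩
      sign (toℕ j) * (M Fin.zero j * 0#)
        ≈⟨ trans (*-congˡ (zeroʳ _)) (zeroʳ _) ⟩
      0# ∎

  replaceColumn : ∀ {n} → Matrix n → Fin n → (Fin n → Carrier) → Matrix n
  replaceColumn M k v r l with l Fin.≟ k
  ... | yes _ = v r
  ... | no  _ = M r l

  replaceColumn-≡ : ∀ {n} (M : Matrix n) k v r → replaceColumn M k v r k ≡ v r
  replaceColumn-≡ M k v r with k Fin.≟ k
  ... | yes _   = ≡.refl
  ... | no  k≢k = ⊥-elim (k≢k ≡.refl)

  replaceColumn-≢ : ∀ {n} (M : Matrix n) {k} v r {l} → l ≢ k → replaceColumn M k v r l ≡ M r l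
  replaceColumn-≢ M {k} v r {l} l≢k with l Fin.≟ k
  ... | yes l≡k = ⊥-elim (l≢k l≡k)
  ... | no  _   = ≡.refl

  replaceColumn-column : ∀ {n} (M : Matrix n) k r l → replaceColumn M k (column M k) r l ≡ M r l
  replaceColumn-column M k r l with l Fin.≟ k
  ... | yes ≡.refl = ≡.refl
  ... | no  _      = ≡.refl

  replaceAdjacentColumns : ∀ {n} → Matrix (suc n) → Fin n → (x y : Fin (suc n) → Carrier) → Matrix (suc n)
  replaceAdjacentColumns M i x y = replaceColumn (replaceColumn M (inject₁ i) x) (Fin.suc i) y

  det-replaceAdjacentColumns-antisym : ∀ {n} (M : Matrix (suc n)) (i : Fin n) (x y : Fin (suc n) → Carrier) →
    det R (suc n) (replaceAdjacentColumns M i x y) + det R (suc n) (replaceAdjacentColumns M i y x) ≈ 0#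
  det-replaceAdjacentColumns-antisym {n} M i x y = begin
    D x y + D y x
      ≈⟨ +-cong (trans (sym (+-identityˡ _)) (+-congʳ (sym (D-diagonal x))))
                (trans (sym (+-identityʳ _)) (+-congˡ (sym (D-diagonal y)))) ⟩
    (D x x + D x y) + (D y x + D y y)
      ≈⟨ +-cong (sym (D-additiveʳ x x y)) (sym (D-additiveʳ y x y)) ⟩
    D x (x ⊕ y) + D y (x ⊕ y)
      ≈⟨ sym (D-additiveˡ x y (x ⊕ y)) ⟩
    D (x ⊕ y) (x ⊕ y)
      ≈⟨ D-diagonal (x ⊕ y) ⟩
    0# ∎
    where
    p = inject₁ i
    q = Fin.suc i
    B = replaceAdjacentColumns M i
    D : (x y : Fin (suc n) → Carrier) → Carrier
    D x y = det R (suc n) (B x y)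
    _⊕_ : (x y : Fin (suc n) → Carrier) → Fin (suc n) → Carrier
    (x ⊕ y) r = x r + y r
    B-p : ∀ x y r → B x y r p ≡ x r
    B-p x y r = ≡.trans (replaceColumn-≢ _ y r (inject₁≢suc i)) (replaceColumn-≡ M p x r)
    B-q : ∀ x y r → B x y r q ≡ y r
    B-q x y r = replaceColumn-≡ _ q y r
    B-off-p : ∀ x x′ y r l → l ≢ p → B x y r l ≈ B x′ y r l
    B-off-p x x′ y r l l≢p with l Fin.≟ q
    ... | yes _ = refl
    ... | no  _ = reflexive (≡.trans (replaceColumn-≢ M x r l≢p) (≡.sym (replaceColumn-≢ M x′ r l≢p)))
    B-off-q : ∀ x y y′ r l → l ≢ q → B x y r l ≈ B x y′ r l
    B-off-q x y y′ r l l≢q =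
      reflexive (≡.trans (replaceColumn-≢ _ y r l≢q) (≡.sym (replaceColumn-≢ _ y′ r l≢q)))
    D-diagonal : ∀ x → D x x ≈ 0#
    D-diagonal x = det-adjacent-equal-columns (B x x) i λ r → reflexive (≡.trans (B-p x x r) (≡.sym (B-q x x r)))
    D-additiveʳ : ∀ x y z → D x (y ⊕ z) ≈ D x y + D x z
    D-additiveʳ x y z = det-additive-column q (B-off-q x _ y) (B-off-q x _ z) λ r →
      reflexive (≡.trans (B-q x _ r) (≡.sym (≡.cong₂ _+_ (B-q x y r) (B-q x z r))))
    D-additiveˡ : ∀ x y z → D (x ⊕ y) z ≈ D x z + D y z
    D-additiveˡ x y z = det-additive-column p (B-off-p _ x z) (B-off-p _ y z) λ r →
      reflexive (≡.trans (B-p _ z r) (≡.sym (≡.cong₂ _+_ (B-p x z r) (B-p y z r))))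

  -- Swapping the columns inject₁ i and suc i brings the copy of column p one step closer.
  det-equal-columns-gap : ∀ d {n} (M : Matrix n) (p q : Fin n) → suc (toℕ p ℕ.+ d) ≡ toℕ q →
                         (∀ r → M r p ≈ M r q) → det R n M ≈ 0#
  det-equal-columns-gap zero {suc n} M p (Fin.suc i) gap same =
    det-adjacent-equal-columns M i λ r → ≡.subst (λ p → M r p ≈ M r (Fin.suc i)) p≡inject₁i (same r)
    where
    p≡inject₁i : p ≡ inject₁ i
    p≡inject₁i = Fin.toℕ-injective
      (≡.trans (≡.sym (ℕ.+-identityʳ (toℕ p)))
               (≡.trans (ℕ.suc-injective gap) (≡.sym (Fin.toℕ-inject₁ i))))
  det-equal-columns-gap (suc d) {suc n} M p (Fin.suc i) gap same = begin
    det R (suc n) M                                  ≈⟨ det-cong (λ r l → sym (B-self r l)) ⟩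
    det R (suc n) (B u v)                            ≈⟨ +-identityʳ _ ⟨
    det R (suc n) (B u v) + 0#                       ≈⟨ +-congˡ swapped-vanishes ⟨
    det R (suc n) (B u v) + det R (suc n) (B v u)    ≈⟨ det-replaceAdjacentColumns-antisym M i u v ⟩
    0#                                               ∎
    where
    u = column M (inject₁ i)
    v = column M (Fin.suc i)
    B = replaceAdjacentColumns M i
    gap′ : suc (toℕ p ℕ.+ d) ≡ toℕ (inject₁ i)
    gap′ = ≡.trans (≡.sym (ℕ.+-suc (toℕ p) d))
                   (≡.trans (ℕ.suc-injective gap) (≡.sym (Fin.toℕ-inject₁ i)))
    p≢inject₁i : p ≢ inject₁ i
    p≢inject₁i eq = ℕ.m≢1+m+n (toℕ p) (≡.trans (≡.cong toℕ eq) (≡.sym gap′))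
    p≢suci : p ≢ Fin.suc i
    p≢suci eq = ℕ.m≢1+m+n (toℕ p) (≡.trans (≡.cong toℕ eq) (≡.sym gap))
    B-self : ∀ r l → B u v r l ≈ M r l
    B-self r l with l Fin.≟ Fin.suc i
    ... | yes ≡.refl = refl
    ... | no  _      = reflexive (replaceColumn-column M (inject₁ i) r l)
    swapped-vanishes : det R (suc n) (B v u) ≈ 0#
    swapped-vanishes = det-equal-columns-gap d (B v u) p (inject₁ i) gap′ λ r → begin
      B v u r p
        ≡⟨ ≡.trans (replaceColumn-≢ _ u r p≢suci) (replaceColumn-≢ M v r p≢inject₁i) ⟩
      M r p
        ≈⟨ same r ⟩
      M r (Fin.suc i)
        ≡⟨ ≡.trans (replaceColumn-≢ _ u r (inject₁≢suc i)) (replaceColumn-≡ M (inject₁ i) v r) ⟨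
      B v u r (inject₁ i) ∎

  det-equal-columns : ∀ {n} (M : Matrix n) {p q : Fin n} → p ≢ q →
                      (∀ r → M r p ≈ M r q) → det R n M ≈ 0#
  det-equal-columns M {p} {q} p≢q same with ℕ.<-cmp (toℕ p) (toℕ q)
  ... | tri< p<q _ _ = det-equal-columns-gap _ M p q (ℕ.m+[n∸m]≡n p<q) same
  ... | tri≈ _ p≡q _ = ⊥-elim (p≢q (Fin.toℕ-injective p≡q))
  ... | tri> _ _ q<p = det-equal-columns-gap _ M q p (ℕ.m+[n∸m]≡n q<p) (sym ∘ same)

  det-replaceColumn-sum : ∀ {n m} (M : Matrix n) (k : Fin n)
                          (w : Fin m → Carrier) (V : Fin m → Fin n → Carrier) →
    det R n (replaceColumn M k (λ r → sumFin R m (λ t → w t * V t r))) ≈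
    sumFin R m (λ t → w t * det R n (replaceColumn M k (V t)))
  det-replaceColumn-sum {m = zero}  M k w V = det-zero-column k λ r → reflexive (replaceColumn-≡ M k _ r)
  det-replaceColumn-sum {n} {suc m} M k w V = begin
    det R n (replaceColumn M k Σ)
      ≈⟨ det-linear-column k (w Fin.zero) 1# (off Σ (V Fin.zero)) (off Σ Σtail) onk ⟩
    w Fin.zero * det R n (replaceColumn M k (V Fin.zero)) + 1# * det R n (replaceColumn M k Σtail)
      ≈⟨ +-congˡ (trans (*-identityˡ _) (det-replaceColumn-sum M k (w ∘ Fin.suc) (V ∘ Fin.suc))) ⟩
    sumFin R (suc m) (λ t → w t * det R n (replaceColumn M k (V t))) ∎
    where
    Σ Σtail : Fin n → Carrier
    Σ r = sumFin R (suc m) (λ t → w t * V t r)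
    Σtail r = sumFin R m (λ t → w (Fin.suc t) * V (Fin.suc t) r)
    off : ∀ u v r l → l ≢ k → replaceColumn M k u r l ≈ replaceColumn M k v r l
    off u v r l l≢k = reflexive (≡.trans (replaceColumn-≢ M u r l≢k) (≡.sym (replaceColumn-≢ M v r l≢k)))
    onk : ∀ r → replaceColumn M k Σ r k ≈
                w Fin.zero * replaceColumn M k (V Fin.zero) r k + 1# * replaceColumn M k Σtail r k
    onk r = begin
      replaceColumn M k Σ r k                        ≡⟨ replaceColumn-≡ M k Σ r ⟩
      w Fin.zero * V Fin.zero r + Σtail r            ≈⟨ +-congˡ (*-identityˡ _) ⟨
      w Fin.zero * V Fin.zero r + 1# * Σtail r
        ≡⟨ ≡.cong₂ (λ a b → w Fin.zero * a + 1# * b)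
                   (replaceColumn-≡ M k _ r) (replaceColumn-≡ M k _ r) ⟨
      w Fin.zero * replaceColumn M k (V Fin.zero) r k + 1# * replaceColumn M k Σtail r k ∎

  det-replaceColumn-combination : ∀ {n} (M : Matrix n) (k : Fin n) (w : Fin n → Carrier) →
    det R n (replaceColumn M k (λ r → sumFin R n (λ t → w t * M r t))) ≈ w k * det R n M
  det-replaceColumn-combination {n} M k w = begin
    det R n (replaceColumn M k (λ r → sumFin R n (λ t → w t * M r t)))
      ≈⟨ det-replaceColumn-sum M k w (column M) ⟩
    sumFin R n (λ t → w t * det R n (replaceColumn M k (column M t)))
      ≈⟨ sumFin-single k other-vanishes ⟩
    w k * det R n (replaceColumn M k (column M k))
      ≈⟨ *-congˡ (det-cong λ r l → reflexive (replaceColumn-column M k r l)) ⟩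
    w k * det R n M ∎
    where
    other-vanishes : ∀ t → t ≢ k → w t * det R n (replaceColumn M k (column M t)) ≈ 0#
    other-vanishes t t≢k = trans (*-congˡ (det-equal-columns _ t≢k λ r →
        reflexive (≡.trans (replaceColumn-≢ M _ r t≢k) (≡.sym (replaceColumn-≡ M k _ r)))))
      (zeroʳ _)

  leadingMinor : ∀ {n} → Matrix (suc n) → Matrix n
  leadingMinor M r l = M (inject₁ r) (inject₁ l)

  det-last-column : ∀ n (M : Matrix (suc n)) → (∀ r → r ≢ Fin.fromℕ n → M r (Fin.fromℕ n) ≈ 0#) →
    det R (suc n) M ≈ M (Fin.fromℕ n) (Fin.fromℕ n) * det R n (leadingMinor M)
  det-last-column zero    M _ = trans (+-identityʳ _) (*-identityˡ _)
  det-last-column (suc n) M above≈0 = begin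
    sumFin R (suc (suc n)) (laplaceTerm M)
      ≈⟨ sumFin-init-last (suc n) (laplaceTerm M) ⟩
    sumFin R (suc n) (laplaceTerm M ∘ inject₁) + laplaceTerm M (Fin.fromℕ (suc n))
      ≈⟨ +-cong (sumFin-cong (suc n) term) last-vanishes ⟩
    sumFin R (suc n) (λ j → corner * laplaceTerm (leadingMinor M) j) + 0#
      ≈⟨ trans (+-identityʳ _) (sym (*-distribˡ-sumFin (suc n) corner (laplaceTerm (leadingMinor M)))) ⟩
    corner * det R (suc n) (leadingMinor M) ∎
    where
    corner = M (Fin.fromℕ (suc n)) (Fin.fromℕ (suc n))
    last-vanishes : laplaceTerm M (Fin.fromℕ (suc n)) ≈ 0#
    last-vanishes = trans (*-congˡ (trans (*-congʳ (above≈0 Fin.zero λ ())) (zeroˡ _))) (zeroʳ _)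
    term : ∀ j → laplaceTerm M (inject₁ j) ≈ corner * laplaceTerm (leadingMinor M) j
    term j = begin
      sign (toℕ (inject₁ j)) * (M Fin.zero (inject₁ j) * det R (suc n) (minor (inject₁ j) M))
        ≈⟨ *-cong (reflexive (≡.cong sign (Fin.toℕ-inject₁ j))) (*-congˡ minor-expansion) ⟩
      sign (toℕ j) * (M Fin.zero (inject₁ j) * (corner * det R n (minor j (leadingMinor M))))
        ≈⟨ solve 4 (λ s x c d → s :* (x :* (c :* d)) := c :* (s :* (x :* d))) refl _ _ corner _ ⟩
      corner * laplaceTerm (leadingMinor M) j ∎
      where
      minor-above≈0 : ∀ r → r ≢ Fin.fromℕ n → minor (inject₁ j) M r (Fin.fromℕ n) ≈ 0#
      minor-above≈0 r r≢ = ≡.subst (λ l → M (Fin.suc r) l ≈ 0#) (≡.sym (punchIn-inject₁-fromℕ j))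
                                   (above≈0 (Fin.suc r) (r≢ ∘ Fin.suc-injective))
      minor-expansion : det R (suc n) (minor (inject₁ j) M) ≈ corner * det R n (minor j (leadingMinor M))
      minor-expansion = trans (det-last-column n (minor (inject₁ j) M) minor-above≈0)
        (*-cong (reflexive (≡.cong (M (Fin.fromℕ (suc n))) (punchIn-inject₁-fromℕ j)))
                (det-cong λ r l → reflexive (≡.cong (M (Fin.suc (inject₁ r))) (punchIn-inject₁ j l))))

  alternatingPowerTerm : ℕ → ℕ → Carrier → ℕ → Carrier
  alternatingPowerTerm n k x j = sign j * (fromℕ R (n C j) * pow R (x + fromℕ R j) k)

  -- (-1)ⁿ times the n-th forward difference of t ↦ tᵏ at x.
  alternatingPowerSum : ℕ → ℕ → Carrier → Carrier
  alternatingPowerSum n k x = sumFin R (suc n) (alternatingPowerTerm n k x ∘ toℕ)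

  +-shift : ∀ x j → x + fromℕ R (suc j) ≈ (x + 1#) + fromℕ R j
  +-shift x j = sym (+-assoc x 1# (fromℕ R j))

  alternatingPowerSum-pascal : ∀ n k x →
    alternatingPowerSum (suc n) k x ≈ alternatingPowerSum n k x - alternatingPowerSum n k (x + 1#)
  alternatingPowerSum-pascal n k x = begin
    T x 0 + sumFin R (suc n) (λ j → T′ x (suc (toℕ j)))
      ≈⟨ +-congˡ (sumFin-cong (suc n) λ j → split (toℕ j)) ⟩
    T x 0 + sumFin R (suc n) (λ j → T x (suc (toℕ j)) + - 1# * T (x + 1#) (toℕ j))
      ≈⟨ +-congˡ (sumFin-distrib-+ (suc n) (λ j → T x (suc (toℕ j)))
                                           (λ j → - 1# * T (x + 1#) (toℕ j))) ⟩
    T x 0 + (sumFin R (suc n) (λ j → T x (suc (toℕ j)))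
             + sumFin R (suc n) (λ j → - 1# * T (x + 1#) (toℕ j)))
      ≈⟨ +-congˡ (+-cong (sumFin-toℕ-last n (T x ∘ suc))
                         (sym (*-distribˡ-sumFin (suc n) (- 1#) (T (x + 1#) ∘ toℕ)))) ⟩
    T x 0 + ((sumFin R n (λ j → T x (suc (toℕ j))) + T x (suc n)) + - 1# * alternatingPowerSum n k (x + 1#))
      ≈⟨ +-congˡ (+-cong (trans (+-congˡ top-vanishes) (+-identityʳ _)) (-1*x≈-x _)) ⟩
    T x 0 + (sumFin R n (λ j → T x (suc (toℕ j))) - alternatingPowerSum n k (x + 1#))
      ≈⟨ +-assoc _ _ _ ⟨
    alternatingPowerSum n k x - alternatingPowerSum n k (x + 1#) ∎
    where
    T T′ : Carrier → ℕ → Carrier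
    T  = alternatingPowerTerm n k
    T′ = alternatingPowerTerm (suc n) k
    top-vanishes : T x (suc n) ≈ 0#
    top-vanishes = begin
      sign (suc n) * (fromℕ R (n C suc n) * P)
        ≡⟨ ≡.cong (λ c → sign (suc n) * (fromℕ R c * P)) (k>n⇒nCk≡0 (ℕ.n<1+n n)) ⟩
      sign (suc n) * (0# * P)
        ≈⟨ trans (*-congˡ (zeroˡ P)) (zeroʳ _) ⟩
      0# ∎
      where P = pow R (x + fromℕ R (suc n)) k
    split : ∀ j → T′ x (suc j) ≈ T x (suc j) + - 1# * T (x + 1#) j
    split j = begin
      sign (suc j) * (fromℕ R (suc n C suc j) * P)
        ≡⟨ ≡.cong (λ c → sign (suc j) * (fromℕ R c * P)) (nCk+nC[k+1]≡[n+1]C[k+1] n j) ⟨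
      sign (suc j) * (fromℕ R (n C j ℕ.+ n C suc j) * P)
        ≈⟨ *-congˡ (*-congʳ (fromℕ-+ (n C j) (n C suc j))) ⟩
      (- 1# * sign j) * ((fromℕ R (n C j) + fromℕ R (n C suc j)) * P)
        ≈⟨ solve 5 (λ m s a b p → (m :* s) :* ((a :+ b) :* p) := (m :* s) :* (b :* p) :+ m :* (s :* (a :* p)))
                 refl (- 1#) (sign j) (fromℕ R (n C j)) (fromℕ R (n C suc j)) P ⟩
      T x (suc j) + - 1# * (sign j * (fromℕ R (n C j) * P))
        ≈⟨ +-congˡ (*-congˡ (*-congˡ (*-congˡ (pow-congˡ k (+-shift x j))))) ⟩
      T x (suc j) + - 1# * T (x + 1#) j ∎
      where P = pow R (x + fromℕ R (suc j)) k

  alternatingPowerSum-absorption : ∀ n k x →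
    alternatingPowerSum (suc n) (suc k) x ≈
    x * alternatingPowerSum (suc n) k x - fromℕ R (suc n) * alternatingPowerSum n k (x + 1#)
  alternatingPowerSum-absorption n k x = begin
    sumFin R (suc (suc n)) (alternatingPowerTerm (suc n) (suc k) x ∘ toℕ)
      ≈⟨ sumFin-cong (suc (suc n)) (λ j → split (toℕ j)) ⟩
    sumFin R (suc (suc n)) (λ j → x * T x (toℕ j) + U (toℕ j))
      ≈⟨ sumFin-distrib-+ (suc (suc n)) (λ j → x * T x (toℕ j)) (U ∘ toℕ) ⟩
    sumFin R (suc (suc n)) (λ j → x * T x (toℕ j)) + sumFin R (suc (suc n)) (U ∘ toℕ)
      ≈⟨ +-cong (sym (*-distribˡ-sumFin (suc (suc n)) x (T x ∘ toℕ))) U-sum ⟩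
    x * alternatingPowerSum (suc n) k x - fromℕ R (suc n) * alternatingPowerSum n k (x + 1#) ∎
    where
    T : Carrier → ℕ → Carrier
    T = alternatingPowerTerm (suc n) k
    U : ℕ → Carrier
    U j = sign j * (fromℕ R (suc n C j) * (fromℕ R j * pow R (x + fromℕ R j) k))
    split : ∀ j → alternatingPowerTerm (suc n) (suc k) x j ≈ x * T x j + U j
    split j = solve 5 (λ s c x f p → s :* (c :* ((x :+ f) :* p)) := x :* (s :* (c :* p)) :+ s :* (c :* (f :* p)))
                refl (sign j) (fromℕ R (suc n C j)) x (fromℕ R j) (pow R (x + fromℕ R j) k)
    U-suc : ∀ j → U (suc j) ≈ - fromℕ R (suc n) * alternatingPowerTerm n k (x + 1#) j
    U-suc j = begin
      (- 1# * sign j) * (fromℕ R (suc n C suc j) * (fromℕ R (suc j) * P))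
        ≈⟨ *-congˡ (solve 3 (λ b f p → b :* (f :* p) := (f :* b) :* p) refl _ _ P) ⟩
      (- 1# * sign j) * ((fromℕ R (suc j) * fromℕ R (suc n C suc j)) * P)
        ≈⟨ *-congˡ (*-congʳ (sym (fromℕ-* (suc j) (suc n C suc j)))) ⟩
      (- 1# * sign j) * (fromℕ R (suc j ℕ.* (suc n C suc j)) * P)
        ≡⟨ ≡.cong (λ c → (- 1# * sign j) * (fromℕ R c * P)) ([k+1]*[n+1]C[k+1]≡[n+1]*nCk n j) ⟩
      (- 1# * sign j) * (fromℕ R (suc n ℕ.* (n C j)) * P)
        ≈⟨ *-congˡ (*-cong (fromℕ-* (suc n) (n C j)) (pow-congˡ k (+-shift x j))) ⟩
      (- 1# * sign j) * ((fromℕ R (suc n) * fromℕ R (n C j)) * P′)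
        ≈⟨ solve 5 (λ m s N c p → (m :* s) :* ((N :* c) :* p) := (m :* N) :* (s :* (c :* p)))
                 refl _ _ _ _ P′ ⟩
      (- 1# * fromℕ R (suc n)) * alternatingPowerTerm n k (x + 1#) j
        ≈⟨ *-congʳ (-1*x≈-x _) ⟩
      - fromℕ R (suc n) * alternatingPowerTerm n k (x + 1#) j ∎
      where
      P  = pow R (x + fromℕ R (suc j)) k
      P′ = pow R ((x + 1#) + fromℕ R j) k
    U-sum : sumFin R (suc (suc n)) (U ∘ toℕ) ≈ - (fromℕ R (suc n) * alternatingPowerSum n k (x + 1#))
    U-sum = begin
      U 0 + sumFin R (suc n) (λ j → U (suc (toℕ j)))
        ≈⟨ +-cong (trans (*-congˡ (trans (*-congˡ (zeroˡ _)) (zeroʳ _))) (zeroʳ _))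
                  (sumFin-cong (suc n) λ j → U-suc (toℕ j)) ⟩
      0# + sumFin R (suc n) (λ j → - fromℕ R (suc n) * alternatingPowerTerm n k (x + 1#) (toℕ j))
        ≈⟨ trans (+-identityˡ _)
                 (sym (*-distribˡ-sumFin (suc n) _ (alternatingPowerTerm n k (x + 1#) ∘ toℕ))) ⟩
      - fromℕ R (suc n) * alternatingPowerSum n k (x + 1#)
        ≈⟨ -‿distribˡ-* _ _ ⟨
      - (fromℕ R (suc n) * alternatingPowerSum n k (x + 1#)) ∎

  alternatingPowerSum≈0 : ∀ {n k} → k ℕ.< n → ∀ x → alternatingPowerSum n k x ≈ 0#
  alternatingPowerSum≈0 {suc n} {zero} _ x =
    trans (alternatingPowerSum-pascal n 0 x) (-‿inverseʳ _)
  alternatingPowerSum≈0 {suc n} {suc k} (s≤s k<n) x = begin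
    alternatingPowerSum (suc n) (suc k) x
      ≈⟨ alternatingPowerSum-absorption n k x ⟩
    x * alternatingPowerSum (suc n) k x - fromℕ R (suc n) * alternatingPowerSum n k (x + 1#)
      ≈⟨ +-cong (*-congˡ (alternatingPowerSum≈0 (ℕ.m<n⇒m<1+n k<n) x))
                (-‿cong (*-congˡ (alternatingPowerSum≈0 k<n (x + 1#)))) ⟩
    x * 0# - fromℕ R (suc n) * 0#
      ≈⟨ trans (+-cong (zeroʳ x) (trans (-‿cong (zeroʳ _)) -0#≈0#)) (+-identityˡ 0#) ⟩
    0# ∎

  leadingBlock : (ℓ : ℕ) → Matrix ℓ
  leadingBlock ℓ r l = fromℕ R ((toℕ r ℕ.* suc ℓ ℕ.+ suc (toℕ l)) ℕ.^ (ℓ ℕ.∸ 1))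

  σ : ℕ → Carrier
  σ ℓ = sign ℓ * det R ℓ (leadingBlock ℓ)

  binomialWeight : (ℓ : ℕ) → Fin (suc ℓ) → Carrier
  binomialWeight ℓ t = sign (toℕ t) * fromℕ R (ℓ C toℕ t)

  binomialWeight-last : ∀ ℓ → binomialWeight ℓ (Fin.fromℕ ℓ) ≈ sign ℓ
  binomialWeight-last ℓ = begin
    sign (toℕ (Fin.fromℕ ℓ)) * fromℕ R (ℓ C toℕ (Fin.fromℕ ℓ))
      ≡⟨ ≡.cong (λ t → sign t * fromℕ R (ℓ C t)) (Fin.toℕ-fromℕ ℓ) ⟩
    sign ℓ * fromℕ R (ℓ C ℓ)
      ≡⟨ ≡.cong (λ c → sign ℓ * fromℕ R c) (nCn≡1 ℓ) ⟩
    sign ℓ * (1# + 0#)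
      ≈⟨ trans (*-congˡ (+-identityʳ 1#)) (*-identityʳ _) ⟩
    sign ℓ ∎

  A-upper : ∀ ℓ s a (r l : Fin (suc ℓ)) → toℕ r ℕ.< ℓ →
            A R ℓ s a r l ≡ fromℕ R ((toℕ r ℕ.* suc ℓ ℕ.+ suc (toℕ l)) ℕ.^ (ℓ ℕ.∸ 1))
  A-upper ℓ s a r l r<ℓ with toℕ r ℕ.<? ℓ
  ... | yes _   = ≡.refl
  ... | no  r≮ℓ = ⊥-elim (r≮ℓ r<ℓ)

  A-last : ∀ ℓ s a l → A R ℓ s a (Fin.fromℕ ℓ) l ≡ fromℕ R (toℕ l ℕ.^ s) * a l
  A-last ℓ s a l with toℕ (Fin.fromℕ ℓ) ℕ.<? ℓ
  ... | yes ℓ<ℓ = ⊥-elim (ℕ.<-irrefl (Fin.toℕ-fromℕ ℓ) ℓ<ℓ)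
  ... | no  _   = ≡.refl

  A-leadingMinor : ∀ ℓ s a r l → leadingMinor (A R ℓ s a) r l ≡ leadingBlock ℓ r l
  A-leadingMinor ℓ s a r l = ≡.trans (A-upper ℓ s a (inject₁ r) (inject₁ l) (Fin.inject₁ℕ< r))
    (≡.cong₂ (λ i j → fromℕ R ((i ℕ.* suc ℓ ℕ.+ suc j) ℕ.^ (ℓ ℕ.∸ 1)))
             (Fin.toℕ-inject₁ r) (Fin.toℕ-inject₁ l))

  A-weighted-upper : ∀ ℓ s a → 1 ≤ ℓ → ∀ r → toℕ r ℕ.< ℓ →
                     sumFin R (suc ℓ) (λ t → binomialWeight ℓ t * A R ℓ s a r t) ≈ 0#
  A-weighted-upper ℓ s a 1≤ℓ r r<ℓ = begin
    sumFin R (suc ℓ) (λ t → binomialWeight ℓ t * A R ℓ s a r t)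
      ≈⟨ sumFin-cong (suc ℓ) term ⟩
    alternatingPowerSum ℓ (ℓ ℕ.∸ 1) (fromℕ R (base ℕ.+ 1))
      ≈⟨ alternatingPowerSum≈0 (ℕ.∸-monoʳ-< {o = 0} (s≤s z≤n) 1≤ℓ) _ ⟩
    0# ∎
    where
    base = toℕ r ℕ.* suc ℓ
    term : ∀ t → binomialWeight ℓ t * A R ℓ s a r t ≈
                 alternatingPowerTerm ℓ (ℓ ℕ.∸ 1) (fromℕ R (base ℕ.+ 1)) (toℕ t)
    term t = begin
      binomialWeight ℓ t * A R ℓ s a r t
        ≡⟨ ≡.cong (binomialWeight ℓ t *_) (A-upper ℓ s a r t r<ℓ) ⟩
      (sign (toℕ t) * fromℕ R (ℓ C toℕ t)) * fromℕ R ((base ℕ.+ suc (toℕ t)) ℕ.^ (ℓ ℕ.∸ 1))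
        ≈⟨ *-assoc _ _ _ ⟩
      sign (toℕ t) * (fromℕ R (ℓ C toℕ t) * fromℕ R ((base ℕ.+ suc (toℕ t)) ℕ.^ (ℓ ℕ.∸ 1)))
        ≈⟨ *-congˡ (*-congˡ (fromℕ-^ _ (ℓ ℕ.∸ 1))) ⟩
      sign (toℕ t) * (fromℕ R (ℓ C toℕ t) * pow R (fromℕ R (base ℕ.+ suc (toℕ t))) (ℓ ℕ.∸ 1))
        ≡⟨ ≡.cong (λ m → sign (toℕ t) * (fromℕ R (ℓ C toℕ t) * pow R (fromℕ R m) (ℓ ℕ.∸ 1)))
                  (ℕ.+-assoc base 1 (toℕ t)) ⟨
      sign (toℕ t) * (fromℕ R (ℓ C toℕ t) * pow R (fromℕ R (base ℕ.+ 1 ℕ.+ toℕ t)) (ℓ ℕ.∸ 1))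
        ≈⟨ *-congˡ (*-congˡ (pow-congˡ (ℓ ℕ.∸ 1) (fromℕ-+ (base ℕ.+ 1) (toℕ t)))) ⟩
      alternatingPowerTerm ℓ (ℓ ℕ.∸ 1) (fromℕ R (base ℕ.+ 1)) (toℕ t) ∎

  A-weighted-last : ∀ ℓ s a →
    sumFin R (suc ℓ) (λ t → binomialWeight ℓ t * A R ℓ s a (Fin.fromℕ ℓ) t) ≈ rhsSum R ℓ s a
  A-weighted-last ℓ s a = sumFin-cong (suc ℓ) λ t →
    trans (*-congˡ (reflexive (A-last ℓ s a t))) (*-assoc (sign (toℕ t)) (fromℕ R (ℓ C toℕ t)) _)

  det-A≈σ*rhsSum : ∀ ℓ → 1 ≤ ℓ → ∀ s a → det R (suc ℓ) (A R ℓ s a) ≈ σ ℓ * rhsSum R ℓ s a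
  det-A≈σ*rhsSum ℓ 1≤ℓ s a = begin
    det R (suc ℓ) M
      ≈⟨ trans (*-congʳ (sign²≈1 ℓ)) (*-identityˡ _) ⟨
    (sign ℓ * sign ℓ) * det R (suc ℓ) M
      ≈⟨ trans (*-assoc _ _ _) (*-congˡ (*-congʳ (sym (binomialWeight-last ℓ)))) ⟩
    sign ℓ * (binomialWeight ℓ last * det R (suc ℓ) M)
      ≈⟨ *-congˡ (det-replaceColumn-combination M last (binomialWeight ℓ)) ⟨
    sign ℓ * det R (suc ℓ) M′
      ≈⟨ *-congˡ (det-last-column ℓ M′ M′-above≈0) ⟩
    sign ℓ * (M′ last last * det R ℓ (leadingMinor M′))
      ≈⟨ *-congˡ (*-cong M′-corner (det-cong λ r l → reflexive (M′-leadingMinor r l))) ⟩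
    sign ℓ * (rhsSum R ℓ s a * det R ℓ (leadingBlock ℓ))
      ≈⟨ solve 3 (λ x y z → x :* (y :* z) := (x :* z) :* y) refl _ _ _ ⟩
    σ ℓ * rhsSum R ℓ s a ∎
    where
    M = A R ℓ s a
    last = Fin.fromℕ ℓ
    M′ = replaceColumn M last (λ r → sumFin R (suc ℓ) (λ t → binomialWeight ℓ t * M r t))
    M′-above≈0 : ∀ r → r ≢ last → M′ r last ≈ 0#
    M′-above≈0 r r≢last =
      trans (reflexive (replaceColumn-≡ M last _ r)) (A-weighted-upper ℓ s a 1≤ℓ r r<ℓ)
      where
      r<ℓ : toℕ r ℕ.< ℓ
      r<ℓ = ℕ.≤∧≢⇒< (ℕ.≤-pred (Fin.toℕ<n r))
              (λ r≡ℓ → r≢last (Fin.toℕ-injective (≡.trans r≡ℓ (≡.sym (Fin.toℕ-fromℕ ℓ)))))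
    M′-corner : M′ last last ≈ rhsSum R ℓ s a
    M′-corner = trans (reflexive (replaceColumn-≡ M last _ last)) (A-weighted-last ℓ s a)
    M′-leadingMinor : ∀ r l → leadingMinor M′ r l ≡ leadingBlock ℓ r l
    M′-leadingMinor r l = ≡.trans (replaceColumn-≢ M _ (inject₁ r) (Fin.fromℕ≢inject₁ ∘ ≡.sym))
                                  (A-leadingMinor ℓ s a r l)

proposition1 : ∀ {c r : Level} (R : CommutativeRing c r) (ℓ : ℕ) → 1 ≤ ℓ →
    ∃ λ (σ : CommutativeRing.Carrier R) →
      ∀ (s : ℕ) (a : Fin (suc ℓ) → CommutativeRing.Carrier R) →
        CommutativeRing._≈_ R (det R (suc ℓ) (A R ℓ s a))
          (CommutativeRing._*_ R σ (rhsSum R ℓ s a))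
proposition1 R ℓ 1≤ℓ = σ R ℓ , det-A≈σ*rhsSum R ℓ 1≤ℓ
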